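{- For every $k\ge2$ and all $x_1,\dots,x_k\in\mathcal O_K$, $$\theta^{ -k}|x_1|_\theta\cdots|x_k|_\theta\le |x_1\cdots x_k|_\theta\le \theta^{k}|x_1|_\theta\cdots|x_k|_\theta .$$
   Context: $\theta>1$ is a real quadratic unit with $N(\theta)=-1$, so $\theta^2=a\theta+1$ with an integer $a\ge1$; $K=\mathbb Q(\theta)\subset\mathbb R$, $\mathcal O_K$ its ring of integers. A greedy polynomial is a finite sum $\sum_{i=m}^M b_i\theta^i$ with $b_i\in\{0,\dots,a\}$ such that $b_i=a$ implies $b_{i-1}=0$. Every nonzero $\alpha\in\mathcal O_K$ can be written uniquely as $\alpha=\pm\sum_{i=m}^M b_i\theta^i$ with the sum a greedy polynomial and $b_m\ne0$. The $\theta$-adic infranorm is $|\alpha|_\theta:=\theta^{ -m}$, and $|0|_\theta:=0$. -}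

module Defs where

open import Data.Nat as ℕ using (ℕ; zero; suc)
open import Data.Integer as ℤ using (ℤ; +_; -[1+_])
open import Data.List using (List; []; _∷_)
open import Data.Fin using (Fin)
open import Data.Product using (Σ; _×_; _,_)
open import Data.Sum using (_⊎_)
open import Data.Unit using (⊤)
open import Data.Empty using (⊥)
import Data.Fin as Fin
open import Relation.Binary.PropositionalEquality using (_≡_; _≢_)

-- Elements of Z[θ] = O_K, written u + v θ, where θ² = a θ + 1.
-- (θ is a unit, so Z[θ] = Z[θ, θ⁻¹].)
record Zθ : Set where
  constructor mk
  field
    re : ℤ
    im : ℤ
open Zθ public

zeroθ : Zθ
zeroθ = mk (+ 0) (+ 0)

oneθ : Zθ
oneθ = mk (+ 1) (+ 0)

θ̂ : Zθ
θ̂ = mk (+ 0) (+ 1)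

-- θ⁻¹ = θ - a  (since θ(θ - a) = θ² - aθ = 1)
θinv : ℕ → Zθ
θinv a = mk (ℤ.- (+ a)) (+ 1)

fromℕθ : ℕ → Zθ
fromℕθ n = mk (+ n) (+ 0)

addθ : Zθ → Zθ → Zθ
addθ (mk u v) (mk u' v') = mk (u ℤ.+ u') (v ℤ.+ v')

negθ : Zθ → Zθ
negθ (mk u v) = mk (ℤ.- u) (ℤ.- v)

subθ : Zθ → Zθ → Zθ
subθ x y = addθ x (negθ y)

mulθ : ℕ → Zθ → Zθ → Zθ
mulθ a (mk u v) (mk u' v') =
  mk (u ℤ.* u' ℤ.+ v ℤ.* v') (u ℤ.* v' ℤ.+ v ℤ.* u' ℤ.+ (+ a) ℤ.* (v ℤ.* v'))

powθ : ℕ → Zθ → ℕ → Zθ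
powθ a x zero = oneθ
powθ a x (suc n) = mulθ a x (powθ a x n)

θ^ : ℕ → ℤ → Zθ
θ^ a (+ n) = powθ a θ̂ n
θ^ a -[1+ n ] = powθ a (θinv a) (suc n)

-- Positivity of u + vθ as a real number, θ = (a + √D)/2, D = a² + 4:
-- 2(u + vθ) = p + q√D with p = 2u + a v, q = v.
Pos : ℕ → Zθ → Set
Pos a (mk u v) =
  let p = (+ 2) ℤ.* u ℤ.+ (+ a) ℤ.* v
      q = v
      D = (+ a) ℤ.* (+ a) ℤ.+ (+ 4)
  in (+ 0 ℤ.< p × + 0 ℤ.≤ q)
   ⊎ (+ 0 ℤ.≤ p × + 0 ℤ.< q)
   ⊎ (+ 0 ℤ.< p × q ℤ.< + 0 × q ℤ.* q ℤ.* D ℤ.< p ℤ.* p)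
   ⊎ (p ℤ.< + 0 × + 0 ℤ.< q × p ℤ.* p ℤ.< q ℤ.* q ℤ.* D)

Leθ : ℕ → Zθ → Zθ → Set
Leθ a x y = x ≡ y ⊎ Pos a (subθ y x)

evalDigits : ℕ → ℤ → List ℕ → Zθ
evalDigits a m [] = zeroθ
evalDigits a m (b ∷ bs) = addθ (mulθ a (fromℕθ b) (θ^ a m)) (evalDigits a (m ℤ.+ + 1) bs)

DigitsLe : ℕ → List ℕ → Set
DigitsLe a [] = ⊤
DigitsLe a (b ∷ bs) = b ℕ.≤ a × DigitsLe a bs

-- b_i = a implies b_{i-1} = 0 (for consecutive digits b_{i-1}, b_i;
-- below the lowest index all coefficients are 0, so nothing to check there)
GreedyAdj : ℕ → List ℕ → Set
GreedyAdj a [] = ⊤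
GreedyAdj a (b ∷ []) = ⊤
GreedyAdj a (b ∷ c ∷ bs) = (c ≡ a → b ≡ 0) × GreedyAdj a (c ∷ bs)

IsGreedyExpansion : ℕ → Zθ → ℤ → List ℕ → Set
IsGreedyExpansion a α m [] = ⊥
IsGreedyExpansion a α m (b ∷ bs) =
  b ≢ 0 × DigitsLe a (b ∷ bs) × GreedyAdj a (b ∷ bs)
  × (α ≡ evalDigits a m (b ∷ bs) ⊎ α ≡ negθ (evalDigits a m (b ∷ bs)))

IsInfranorm : ℕ → Zθ → Zθ → Set
IsInfranorm a α r =
  (α ≡ zeroθ × r ≡ zeroθ)
  ⊎ Σ ℤ (λ m → Σ (List ℕ) (λ bs → IsGreedyExpansion a α m bs × r ≡ θ^ a (ℤ.- m)))

prodθ : ℕ → (k : ℕ) → (Fin k → Zθ) → Zθ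
prodθ a zero f = oneθ
prodθ a (suc k) f = mulθ a (f Fin.zero) (prodθ a k (λ i → f (Fin.suc i)))

-- Let σ be the Galois conjugation θ ↦ −θ⁻¹. For a greedy expansion α = ±Σᵢ bᵢ θ^(m+i) with b₀ ≠ 0,
-- σ(α) = ±θ^(−m) · t where t = Σᵢ bᵢ (−θ⁻¹)ⁱ, and the greedy conditions force θ⁻¹ < t < θ; so up to
-- sign σ(α) is |α|_θ times a cofactor in (θ⁻¹, θ). Since σ is multiplicative, σ(x₁⋯x_k) is, up to sign,
-- both |x₁⋯x_k|_θ · t and ∏|xᵢ|_θ · ∏tᵢ with θ^(−k) ≤ ∏tᵢ ≤ θ^k. Hence the two infranorms differ by a
-- power of θ strictly between θ^(−k−1) and θ^(k+1), that is, by at most θ^(±k). Order in ℤ[θ] ⊂ ℝ is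
-- handled through the cone θ^ℤ · (ℕ[θ] ∖ 0): it is closed under + and ·, and lies in the positive reals.

module Submission where

open import Defs
open import Data.Nat as ℕ using (ℕ; zero; suc; z≤n; s≤s)
import Data.Nat.Properties as ℕ
open import Data.Integer as ℤ using (ℤ; +_; -[1+_]; +≤+; +<+)
import Data.Integer.Properties as ℤ
import Data.Integer.Tactic.RingSolver as ℤ-Solver
import Data.Nat.Tactic.RingSolver as ℕ-Solver
open import Data.Fin as Fin using (Fin)
open import Data.List using (List; []; _∷_; head)
open import Data.Maybe as Maybe using (Maybe; just)
open import Data.Product as Product using (Σ-syntax; _×_; _,_; proj₁; proj₂)
open import Data.Sum using (_⊎_; inj₁; inj₂)
open import Data.Empty using (⊥-elim)
open import Function using (_∘_)
open import Level using (0ℓ)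
open import Relation.Nullary using (¬_; yes; no)
open import Relation.Nullary.Decidable using (dec⇒maybe)
open import Relation.Binary.PropositionalEquality
open import Algebra.Bundles using (CommutativeRing)
open import Algebra.Structures {A = Zθ} _≡_ using (IsCommutativeRing)
import Algebra.Solver.Ring.AlmostCommutativeRing as ACR
import Relation.Binary.Reasoning.Base.Triple as Triple
open import Relation.Binary.Structures using (IsPreorder)
open import Relation.Binary.Definitions using (Asymmetric; Transitive; _Respects₂_)
import Algebra.Properties.CommutativeSemigroup ℤ.+-commutativeSemigroup as ℤ+

ℤ-induction : ∀ {ℓ} (P : ℤ → Set ℓ) → P (+ 0) → (∀ e → P e → P (ℤ.suc e)) → (∀ e → P e → P (ℤ.pred e)) →
              ∀ e → P e
ℤ-induction P P0 P-suc P-pred (+ zero) = P0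
ℤ-induction P P0 P-suc P-pred (+ suc n) = P-suc (+ n) (ℤ-induction P P0 P-suc P-pred (+ n))
ℤ-induction P P0 P-suc P-pred -[1+ zero ] = P-pred (+ 0) P0
ℤ-induction P P0 P-suc P-pred -[1+ suc n ] = P-pred -[1+ n ] (ℤ-induction P P0 P-suc P-pred -[1+ n ])

module CoordinateSigns (a : ℕ) where

  open import Data.Integer using (_+_; _*_; _-_; -_; _≤_; _<_; 0ℤ)
  open ℤ.≤-Reasoning

  private
    A : ℤ
    A = + a

    0≤A : 0ℤ ≤ A
    0≤A = +≤+ z≤n

    0≤* : ∀ {x y} → 0ℤ ≤ x → 0ℤ ≤ y → 0ℤ ≤ x * y
    0≤* {x} {y} 0≤x 0≤y = subst (_≤ x * y) (ℤ.*-zeroʳ x) (ℤ.*-monoˡ-≤-nonNeg x {{ℤ.nonNegative 0≤x}} 0≤y)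

    0<* : ∀ {x y} → 0ℤ < x → 0ℤ < y → 0ℤ < x * y
    0<* {x} {y} 0<x 0<y = subst (_< x * y) (ℤ.*-zeroʳ x) (ℤ.*-monoˡ-<-pos x {{ℤ.positive 0<x}} 0<y)

    *≤0 : ∀ {x y} → 0ℤ ≤ x → y ≤ 0ℤ → x * y ≤ 0ℤ
    *≤0 {x} {y} 0≤x y≤0 = subst (x * y ≤_) (ℤ.*-zeroʳ x) (ℤ.*-monoˡ-≤-nonNeg x {{ℤ.nonNegative 0≤x}} y≤0)

    0≤² : ∀ x → 0ℤ ≤ x * x
    0≤² x with ℤ.≤-total 0ℤ x
    ... | inj₁ 0≤x = 0≤* 0≤x 0≤x
    ... | inj₂ x≤0 = subst (_≤ x * x) (ℤ.*-zeroʳ x) (ℤ.*-monoˡ-≤-nonPos x {{ℤ.nonPositive x≤0}} x≤0)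

    ≤-+nonNeg : ∀ x {y} → 0ℤ ≤ y → x ≤ x + y
    ≤-+nonNeg x {y} 0≤y = ℤ.i≤i+j x y {{ℤ.nonNegative 0≤y}}

    -nonNeg≤ : ∀ x {y} → 0ℤ ≤ y → x - y ≤ x
    -nonNeg≤ x {y} 0≤y = ℤ.i-j≤i x y {{ℤ.nonNegative 0≤y}}

    <-+pos : ∀ x {y} → 0ℤ < y → x < x + y
    <-+pos x {y} 0<y = subst (_< x + y) (ℤ.+-identityʳ x) (ℤ.+-monoʳ-< x 0<y)

    +neg-< : ∀ x {y} → y < 0ℤ → x + y < x
    +neg-< x {y} y<0 = subst (x + y <_) (ℤ.+-identityʳ x) (ℤ.+-monoʳ-< x y<0)

  norm : ℤ → ℤ → ℤ
  norm u v = u * u + A * (u * v) - v * v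

  -- u + vθ > 0, read off from the signs of u, v and of the norm (u + vθ)(u + vθ′), where θ′ = −θ⁻¹ < 0.
  PositiveCoords : ℤ → ℤ → Set
  PositiveCoords u v = (0ℤ ≤ u × 0ℤ ≤ v × (0ℤ < u ⊎ 0ℤ < v))
                     ⊎ (0ℤ < u × v < 0ℤ × 0ℤ < norm u v)
                     ⊎ (u < 0ℤ × 0ℤ < v × norm u v < 0ℤ)

  private
    norm-θ⁻¹ : ∀ u v → norm (v - A * u) u ≡ - norm u v
    norm-θ⁻¹ = identity A
      where
      identity : ∀ A u v → (v - A * u) * (v - A * u) + A * ((v - A * u) * u) - u * u
                           ≡ - (u * u + A * (u * v) - v * v)
      identity = ℤ-Solver.solve-∀

    norm-via-θ⁻¹ : ∀ u v → norm u v ≡ u * u - v * (v - A * u)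
    norm-via-θ⁻¹ = identity A
      where
      identity : ∀ A u v → u * u + A * (u * v) - v * v ≡ u * u - v * (v - A * u)
      identity = ℤ-Solver.solve-∀

    norm-via-θ : ∀ u v → norm u v ≡ u * (u + A * v) - v * v
    norm-via-θ = identity A
      where
      identity : ∀ A u v → u * u + A * (u * v) - v * v ≡ u * (u + A * v) - v * v
      identity = ℤ-Solver.solve-∀

    0<u⇒PositiveCoords-θ⁻¹ : ∀ {u v} → 0ℤ < u → 0ℤ ≤ v → PositiveCoords (v - A * u) u
    0<u⇒PositiveCoords-θ⁻¹ {u} {v} 0<u 0≤v with 0ℤ ℤ.≤? v - A * u
    ... | yes 0≤w = inj₁ (0≤w , ℤ.<⇒≤ 0<u , inj₂ 0<u)
    ... | no 0≰w = inj₂ (inj₂ (ℤ.≰⇒> 0≰w , 0<u , subst (_< 0ℤ) (sym (norm-θ⁻¹ u v)) (ℤ.neg-mono-< 0<N)))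
      where
      0<N : 0ℤ < norm u v
      0<N = begin-strict
        0ℤ                         <⟨ 0<* 0<u 0<u ⟩
        u * u                      ≤⟨ ≤-+nonNeg (u * u) (ℤ.neg-mono-≤ (*≤0 0≤v (ℤ.<⇒≤ (ℤ.≰⇒> 0≰w)))) ⟩
        u * u - v * (v - A * u)    ≡⟨ norm-via-θ⁻¹ u v ⟨
        norm u v                   ∎

  PositiveCoords-θ⁻¹ : ∀ {u v} → PositiveCoords u v → PositiveCoords (v - A * u) u
  PositiveCoords-θ⁻¹ (inj₁ (0≤u , 0≤v , inj₁ 0<u)) = 0<u⇒PositiveCoords-θ⁻¹ 0<u 0≤v
  PositiveCoords-θ⁻¹ {u} {v} (inj₁ (0≤u , 0≤v , inj₂ 0<v)) with 0ℤ ℤ.<? u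
  ... | yes 0<u = 0<u⇒PositiveCoords-θ⁻¹ 0<u 0≤v
  ... | no 0≮u with ℤ.≤-antisym (ℤ.≮⇒≥ 0≮u) 0≤u
  ...   | refl = inj₁ (subst (0ℤ ≤_) (sym (v-A*0 A v)) 0≤v , 0≤u , inj₁ (subst (0ℤ <_) (sym (v-A*0 A v)) 0<v))
    where
    v-A*0 : ∀ A v → v - A * 0ℤ ≡ v
    v-A*0 = ℤ-Solver.solve-∀
  PositiveCoords-θ⁻¹ {u} {v} (inj₂ (inj₁ (0<u , v<0 , 0<N))) =
    inj₂ (inj₂ (ℤ.≤-<-trans (-nonNeg≤ v (0≤* 0≤A (ℤ.<⇒≤ 0<u))) v<0 , 0<u ,
                subst (_< 0ℤ) (sym (norm-θ⁻¹ u v)) (ℤ.neg-mono-< 0<N)))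
  PositiveCoords-θ⁻¹ {u} {v} (inj₂ (inj₂ (u<0 , 0<v , N<0))) =
    inj₂ (inj₁ (ℤ.<-≤-trans 0<v (≤-+nonNeg v (ℤ.neg-mono-≤ (*≤0 0≤A (ℤ.<⇒≤ u<0)))) , u<0 ,
                subst (0ℤ <_) (sym (norm-θ⁻¹ u v)) (ℤ.neg-mono-< N<0)))

  private
    0<u+Av : ∀ {u v} → 0ℤ < u → 0ℤ < norm u v → 0ℤ < u + A * v
    0<u+Av {u} {v} 0<u 0<N with 0ℤ ℤ.<? u + A * v
    ... | yes 0<w = 0<w
    ... | no 0≮w = ⊥-elim (ℤ.<⇒≱ 0<N (begin
      norm u v                   ≡⟨ norm-via-θ u v ⟩
      u * (u + A * v) - v * v    ≤⟨ -nonNeg≤ (u * (u + A * v)) (0≤² v) ⟩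
      u * (u + A * v)            ≤⟨ *≤0 (ℤ.<⇒≤ 0<u) (ℤ.≮⇒≥ 0≮w) ⟩
      0ℤ                         ∎))

    -- p = 2u + av and q = v are the coordinates of 2(u + vθ) = p + q√D used by Pos, with D = a² + 4.
    p²≡q²D+4norm : ∀ u v → (+ 2 * u + A * v) * (+ 2 * u + A * v) ≡ v * v * (A * A + + 4) + + 4 * norm u v
    p²≡q²D+4norm = identity A
      where
      identity : ∀ A u v → (+ 2 * u + A * v) * (+ 2 * u + A * v)
                           ≡ v * v * (A * A + + 4) + + 4 * (u * u + A * (u * v) - v * v)
      identity = ℤ-Solver.solve-∀

    p≡u+[u+Av] : ∀ u v → + 2 * u + A * v ≡ u + (u + A * v)
    p≡u+[u+Av] = identity A
      where
      identity : ∀ A u v → + 2 * u + A * v ≡ u + (u + A * v)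
      identity = ℤ-Solver.solve-∀

    0<2 : 0ℤ < + 2
    0<2 = +<+ (s≤s z≤n)

    0<4 : 0ℤ < + 4
    0<4 = +<+ (s≤s z≤n)

  PositiveCoords⇒Pos : ∀ {u v} → PositiveCoords u v → Pos a (mk u v)
  PositiveCoords⇒Pos (inj₁ (0≤u , 0≤v , inj₁ 0<u)) =
    inj₁ (ℤ.+-mono-<-≤ (0<* 0<2 0<u) (0≤* 0≤A 0≤v) , 0≤v)
  PositiveCoords⇒Pos (inj₁ (0≤u , 0≤v , inj₂ 0<v)) =
    inj₂ (inj₁ (ℤ.+-mono-≤ (0≤* (ℤ.<⇒≤ 0<2) 0≤u) (0≤* 0≤A 0≤v) , 0<v))
  PositiveCoords⇒Pos {u} {v} (inj₂ (inj₁ (0<u , v<0 , 0<N))) =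
    inj₂ (inj₂ (inj₁ (subst (0ℤ <_) (sym (p≡u+[u+Av] u v)) (ℤ.+-mono-< 0<u (0<u+Av 0<u 0<N)) , v<0 ,
      subst (_ <_) (sym (p²≡q²D+4norm u v)) (<-+pos (v * v * (A * A + + 4)) (0<* 0<4 0<N)))))
  PositiveCoords⇒Pos {u} {v} (inj₂ (inj₂ (u<0 , 0<v , N<0))) with 0ℤ ℤ.≤? + 2 * u + A * v
  ... | yes 0≤p = inj₂ (inj₁ (0≤p , 0<v))
  ... | no 0≰p = inj₂ (inj₂ (inj₂ (ℤ.≰⇒> 0≰p , 0<v ,
      subst (_< _) (sym (p²≡q²D+4norm u v)) (+neg-< (v * v * (A * A + + 4)) 4norm<0))))
    where
    4norm<0 : + 4 * norm u v < 0ℤ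
    4norm<0 = subst (_< 0ℤ) (ℤ.*-comm (norm u v) (+ 4)) (ℤ.*-monoʳ-<-pos (+ 4) N<0)

module ℤ[θ] (a : ℕ) where

  infixl 6 _+_ _-_
  infixl 7 _*_
  infix 8 -_

  _+_ : Zθ → Zθ → Zθ
  _+_ = addθ

  -_ : Zθ → Zθ
  -_ = negθ

  _-_ : Zθ → Zθ → Zθ
  _-_ = subθ

  _*_ : Zθ → Zθ → Zθ
  _*_ = mulθ a

  private
    A : ℤ
    A = + a

  +-assoc : ∀ x y z → (x + y) + z ≡ x + (y + z)
  +-assoc (mk u v) (mk u′ v′) (mk u″ v″) = cong₂ mk (ℤ.+-assoc u u′ u″) (ℤ.+-assoc v v′ v″)

  +-comm : ∀ x y → x + y ≡ y + x
  +-comm (mk u v) (mk u′ v′) = cong₂ mk (ℤ.+-comm u u′) (ℤ.+-comm v v′)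

  +-identityˡ : ∀ x → zeroθ + x ≡ x
  +-identityˡ (mk u v) = cong₂ mk (ℤ.+-identityˡ u) (ℤ.+-identityˡ v)

  +-identityʳ : ∀ x → x + zeroθ ≡ x
  +-identityʳ (mk u v) = cong₂ mk (ℤ.+-identityʳ u) (ℤ.+-identityʳ v)

  -‿inverseˡ : ∀ x → - x + x ≡ zeroθ
  -‿inverseˡ (mk u v) = cong₂ mk (ℤ.+-inverseˡ u) (ℤ.+-inverseˡ v)

  -‿inverseʳ : ∀ x → x + - x ≡ zeroθ
  -‿inverseʳ (mk u v) = cong₂ mk (ℤ.+-inverseʳ u) (ℤ.+-inverseʳ v)

  *-assoc : ∀ x y z → (x * y) * z ≡ x * (y * z)
  *-assoc (mk u v) (mk u′ v′) (mk u″ v″) = cong₂ mk (re-assoc A u v u′ v′ u″ v″) (im-assoc A u v u′ v′ u″ v″)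
    where
    re-assoc : ∀ A u v u′ v′ u″ v″ →
      (u ℤ.* u′ ℤ.+ v ℤ.* v′) ℤ.* u″ ℤ.+ (u ℤ.* v′ ℤ.+ v ℤ.* u′ ℤ.+ A ℤ.* (v ℤ.* v′)) ℤ.* v″
        ≡ u ℤ.* (u′ ℤ.* u″ ℤ.+ v′ ℤ.* v″) ℤ.+ v ℤ.* (u′ ℤ.* v″ ℤ.+ v′ ℤ.* u″ ℤ.+ A ℤ.* (v′ ℤ.* v″))
    re-assoc = ℤ-Solver.solve-∀
    im-assoc : ∀ A u v u′ v′ u″ v″ →
      (u ℤ.* u′ ℤ.+ v ℤ.* v′) ℤ.* v″ ℤ.+ (u ℤ.* v′ ℤ.+ v ℤ.* u′ ℤ.+ A ℤ.* (v ℤ.* v′)) ℤ.* u″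
        ℤ.+ A ℤ.* ((u ℤ.* v′ ℤ.+ v ℤ.* u′ ℤ.+ A ℤ.* (v ℤ.* v′)) ℤ.* v″)
        ≡ u ℤ.* (u′ ℤ.* v″ ℤ.+ v′ ℤ.* u″ ℤ.+ A ℤ.* (v′ ℤ.* v″)) ℤ.+ v ℤ.* (u′ ℤ.* u″ ℤ.+ v′ ℤ.* v″)
          ℤ.+ A ℤ.* (v ℤ.* (u′ ℤ.* v″ ℤ.+ v′ ℤ.* u″ ℤ.+ A ℤ.* (v′ ℤ.* v″)))
    im-assoc = ℤ-Solver.solve-∀

  *-comm : ∀ x y → x * y ≡ y * x
  *-comm (mk u v) (mk u′ v′) = cong₂ mk (re-comm u v u′ v′) (im-comm A u v u′ v′)
    where
    re-comm : ∀ u v u′ v′ → u ℤ.* u′ ℤ.+ v ℤ.* v′ ≡ u′ ℤ.* u ℤ.+ v′ ℤ.* v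
    re-comm = ℤ-Solver.solve-∀
    im-comm : ∀ A u v u′ v′ →
      u ℤ.* v′ ℤ.+ v ℤ.* u′ ℤ.+ A ℤ.* (v ℤ.* v′) ≡ u′ ℤ.* v ℤ.+ v′ ℤ.* u ℤ.+ A ℤ.* (v′ ℤ.* v)
    im-comm = ℤ-Solver.solve-∀

  *-identityˡ : ∀ x → oneθ * x ≡ x
  *-identityˡ (mk u v) = cong₂ mk (re-identity u v) (im-identity A u v)
    where
    re-identity : ∀ u v → + 1 ℤ.* u ℤ.+ + 0 ℤ.* v ≡ u
    re-identity = ℤ-Solver.solve-∀
    im-identity : ∀ A u v → + 1 ℤ.* v ℤ.+ + 0 ℤ.* u ℤ.+ A ℤ.* (+ 0 ℤ.* v) ≡ v
    im-identity = ℤ-Solver.solve-∀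

  *-distribˡ-+ : ∀ x y z → x * (y + z) ≡ x * y + x * z
  *-distribˡ-+ (mk u v) (mk u′ v′) (mk u″ v″) =
    cong₂ mk (re-distrib u v u′ v′ u″ v″) (im-distrib A u v u′ v′ u″ v″)
    where
    re-distrib : ∀ u v u′ v′ u″ v″ →
      u ℤ.* (u′ ℤ.+ u″) ℤ.+ v ℤ.* (v′ ℤ.+ v″) ≡ (u ℤ.* u′ ℤ.+ v ℤ.* v′) ℤ.+ (u ℤ.* u″ ℤ.+ v ℤ.* v″)
    re-distrib = ℤ-Solver.solve-∀
    im-distrib : ∀ A u v u′ v′ u″ v″ →
      u ℤ.* (v′ ℤ.+ v″) ℤ.+ v ℤ.* (u′ ℤ.+ u″) ℤ.+ A ℤ.* (v ℤ.* (v′ ℤ.+ v″))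
        ≡ (u ℤ.* v′ ℤ.+ v ℤ.* u′ ℤ.+ A ℤ.* (v ℤ.* v′)) ℤ.+ (u ℤ.* v″ ℤ.+ v ℤ.* u″ ℤ.+ A ℤ.* (v ℤ.* v″))
    im-distrib = ℤ-Solver.solve-∀

  isCommutativeRing : IsCommutativeRing _+_ _*_ -_ zeroθ oneθ
  isCommutativeRing = record
    { isRing = record
      { +-isAbelianGroup = record
        { isGroup = record
          { isMonoid = record
            { isSemigroup = record
              { isMagma = record { isEquivalence = isEquivalence ; ∙-cong = cong₂ _+_ }
              ; assoc = +-assoc }
            ; identity = +-identityˡ , +-identityʳ }
          ; inverse = -‿inverseˡ , -‿inverseʳ
          ; ⁻¹-cong = cong (-_) }
        ; comm = +-comm }
      ; *-cong = cong₂ _*_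
      ; *-assoc = *-assoc
      ; *-identity = *-identityˡ , λ x → trans (*-comm x oneθ) (*-identityˡ x)
      ; distrib = *-distribˡ-+ , λ x y z →
          trans (*-comm (y + z) x) (trans (*-distribˡ-+ x y z) (cong₂ _+_ (*-comm x y) (*-comm x z))) }
    ; *-comm = *-comm }

  commutativeRing : CommutativeRing 0ℓ 0ℓ
  commutativeRing = record { isCommutativeRing = isCommutativeRing }

  private
    embed : ℤ → Zθ
    embed c = mk c (+ 0)

    embed-* : ∀ c d → embed (c ℤ.* d) ≡ embed c * embed d
    embed-* c d = cong₂ mk (sym (ℤ.+-identityʳ (c ℤ.* d))) (vanishes A c d)
      where
      vanishes : ∀ A c d → + 0 ≡ c ℤ.* + 0 ℤ.+ + 0 ℤ.* d ℤ.+ A ℤ.* (+ 0 ℤ.* + 0)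
      vanishes = ℤ-Solver.solve-∀

    embedding : ℤ.+-*-rawRing ACR.-Raw-AlmostCommutative⟶ ACR.fromCommutativeRing commutativeRing
    embedding = record
      { ⟦_⟧ = embed
      ; +-homo = λ _ _ → refl
      ; *-homo = embed-*
      ; -‿homo = λ _ → refl
      ; 0-homo = refl
      ; 1-homo = refl
      }

    embed-≟ : ∀ c d → Maybe (embed c ≡ embed d)
    embed-≟ c d = Maybe.map (cong embed) (dec⇒maybe (c ℤ.≟ d))

  open import Algebra.Solver.Ring ℤ.+-*-rawRing (ACR.fromCommutativeRing commutativeRing) embedding embed-≟
    using (solve; _:+_; _:*_; :-_; _:-_; con; _:=_)

  open CommutativeRing commutativeRing public using (zeroˡ; zeroʳ; *-identityʳ)

  θ⁻¹ : Zθ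
  θ⁻¹ = θinv a

  θ*-coords : ∀ u v → θ̂ * mk u v ≡ mk v (u ℤ.+ A ℤ.* v)
  θ*-coords u v = cong₂ mk (re-eq u v) (im-eq A u v)
    where
    re-eq : ∀ u v → + 0 ℤ.* u ℤ.+ + 1 ℤ.* v ≡ v
    re-eq = ℤ-Solver.solve-∀
    im-eq : ∀ A u v → + 0 ℤ.* v ℤ.+ + 1 ℤ.* u ℤ.+ A ℤ.* (+ 1 ℤ.* v) ≡ u ℤ.+ A ℤ.* v
    im-eq = ℤ-Solver.solve-∀

  θ⁻¹*-coords : ∀ u v → θ⁻¹ * mk u v ≡ mk (v ℤ.- A ℤ.* u) u
  θ⁻¹*-coords u v = cong₂ mk (re-eq A u v) (im-eq A u v)
    where
    re-eq : ∀ A u v → ℤ.- A ℤ.* u ℤ.+ + 1 ℤ.* v ≡ v ℤ.- A ℤ.* u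
    re-eq = ℤ-Solver.solve-∀
    im-eq : ∀ A u v → ℤ.- A ℤ.* v ℤ.+ + 1 ℤ.* u ℤ.+ A ℤ.* (+ 1 ℤ.* v) ≡ u
    im-eq = ℤ-Solver.solve-∀

  θ*θ⁻¹ : θ̂ * θ⁻¹ ≡ oneθ
  θ*θ⁻¹ = trans (θ*-coords (ℤ.- A) (+ 1)) (cong (mk (+ 1)) (cancel A))
    where
    cancel : ∀ A → ℤ.- A ℤ.+ A ℤ.* + 1 ≡ + 0
    cancel = ℤ-Solver.solve-∀

  θ⁻¹*θ : θ⁻¹ * θ̂ ≡ oneθ
  θ⁻¹*θ = trans (*-comm θ⁻¹ θ̂) θ*θ⁻¹

  cancel-inverse : ∀ u w → u * w ≡ oneθ → ∀ x → u * (w * x) ≡ x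
  cancel-inverse u w uw≡1 x = trans (sym (*-assoc u w x)) (trans (cong (_* x) uw≡1) (*-identityˡ x))

  θ^-suc : ∀ e → θ^ a (ℤ.suc e) ≡ θ̂ * θ^ a e
  θ^-suc (+ n) = refl
  θ^-suc -[1+ zero ] = sym (trans (cong (θ̂ *_) (*-identityʳ θ⁻¹)) θ*θ⁻¹)
  θ^-suc -[1+ suc n ] = sym (cancel-inverse θ̂ θ⁻¹ θ*θ⁻¹ (θ^ a -[1+ n ]))

  θ^-pred : ∀ e → θ^ a (ℤ.pred e) ≡ θ⁻¹ * θ^ a e
  θ^-pred e = begin
    θ^ a (ℤ.pred e)                ≡⟨ cancel-inverse θ⁻¹ θ̂ θ⁻¹*θ (θ^ a (ℤ.pred e)) ⟨
    θ⁻¹ * (θ̂ * θ^ a (ℤ.pred e))    ≡⟨ cong (θ⁻¹ *_) (θ^-suc (ℤ.pred e)) ⟨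
    θ⁻¹ * θ^ a (ℤ.suc (ℤ.pred e))  ≡⟨ cong (λ e → θ⁻¹ * θ^ a e) (ℤ.suc-pred e) ⟩
    θ⁻¹ * θ^ a e                   ∎
    where open ≡-Reasoning

  θ^-+ : ∀ e f → θ^ a (e ℤ.+ f) ≡ θ^ a e * θ^ a f
  θ^-+ e = ℤ-induction (λ f → θ^ a (e ℤ.+ f) ≡ θ^ a e * θ^ a f)
    (trans (cong (θ^ a) (ℤ.+-identityʳ e)) (sym (*-identityʳ (θ^ a e))))
    (shift (+ 1) θ̂ θ^-suc) (shift -[1+ 0 ] θ⁻¹ θ^-pred)
    where
    shift : ∀ c u → (∀ f → θ^ a (c ℤ.+ f) ≡ u * θ^ a f) → ∀ f →
            θ^ a (e ℤ.+ f) ≡ θ^ a e * θ^ a f → θ^ a (e ℤ.+ (c ℤ.+ f)) ≡ θ^ a e * θ^ a (c ℤ.+ f)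
    shift c u θ^-c+ f ih = begin
      θ^ a (e ℤ.+ (c ℤ.+ f))   ≡⟨ cong (θ^ a) (ℤ+.x∙yz≈y∙xz e c f) ⟩
      θ^ a (c ℤ.+ (e ℤ.+ f))   ≡⟨ θ^-c+ (e ℤ.+ f) ⟩
      u * θ^ a (e ℤ.+ f)       ≡⟨ cong (u *_) ih ⟩
      u * (θ^ a e * θ^ a f)    ≡⟨ solve 3 (λ u x y → u :* (x :* y) := x :* (u :* y)) refl u (θ^ a e) (θ^ a f) ⟩
      θ^ a e * (u * θ^ a f)    ≡⟨ cong (θ^ a e *_) (θ^-c+ f) ⟨
      θ^ a e * θ^ a (c ℤ.+ f)  ∎
      where open ≡-Reasoning

  data ℕ[θ]⁺ : Zθ → Set where
    coords : ∀ u v → 1 ℕ.≤ u ℕ.+ v → ℕ[θ]⁺ (mk (+ u) (+ v))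

  ℕ[θ]⁺-+ : ∀ {X Y} → ℕ[θ]⁺ X → ℕ[θ]⁺ Y → ℕ[θ]⁺ (X + Y)
  ℕ[θ]⁺-+ (coords u v 1≤u+v) (coords u′ v′ _) =
    coords (u ℕ.+ u′) (v ℕ.+ v′) (ℕ.≤-trans 1≤u+v (ℕ.+-mono-≤ (ℕ.m≤m+n u u′) (ℕ.m≤m+n v v′)))

  ℕ[θ]⁺-θ* : ∀ {X} → ℕ[θ]⁺ X → ℕ[θ]⁺ (θ̂ * X)
  ℕ[θ]⁺-θ* (coords u v 1≤u+v) =
    subst ℕ[θ]⁺ (sym (trans (θ*-coords (+ u) (+ v)) (cong (λ w → mk (+ v) (+ u ℤ.+ w)) (sym (ℤ.pos-* a v)))))
      (coords v (u ℕ.+ a ℕ.* v) (ℕ.≤-trans 1≤u+v (ℕ.≤-trans (ℕ.≤-reflexive (ℕ.+-comm u v))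
        (ℕ.+-monoʳ-≤ v (ℕ.m≤m+n u (a ℕ.* v))))))

  ℕ[θ]⁺-θ^ : ∀ d {X} → ℕ[θ]⁺ X → ℕ[θ]⁺ (θ^ a (+ d) * X)
  ℕ[θ]⁺-θ^ zero {X} X⁺ = subst ℕ[θ]⁺ (sym (*-identityˡ X)) X⁺
  ℕ[θ]⁺-θ^ (suc d) {X} X⁺ = subst ℕ[θ]⁺ (sym (*-assoc θ̂ (θ^ a (+ d)) X)) (ℕ[θ]⁺-θ* (ℕ[θ]⁺-θ^ d X⁺))

  ℕ[θ]⁺-* : ∀ {X Y} → ℕ[θ]⁺ X → ℕ[θ]⁺ Y → ℕ[θ]⁺ (X * Y)
  ℕ[θ]⁺-* (coords u v 1≤u+v) (coords u′ v′ 1≤u′+v′) = subst ℕ[θ]⁺ (sym coords-*)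
    (coords (u ℕ.* u′ ℕ.+ v ℕ.* v′) (u ℕ.* v′ ℕ.+ v ℕ.* u′ ℕ.+ a ℕ.* (v ℕ.* v′))
      (ℕ.≤-trans (ℕ.*-mono-≤ 1≤u+v 1≤u′+v′)
        (ℕ.≤-trans (ℕ.m≤m+n _ (a ℕ.* (v ℕ.* v′))) (ℕ.≤-reflexive (expand a u v u′ v′)))))
    where
    expand : ∀ a u v u′ v′ → (u ℕ.+ v) ℕ.* (u′ ℕ.+ v′) ℕ.+ a ℕ.* (v ℕ.* v′)
                             ≡ (u ℕ.* u′ ℕ.+ v ℕ.* v′) ℕ.+ (u ℕ.* v′ ℕ.+ v ℕ.* u′ ℕ.+ a ℕ.* (v ℕ.* v′))
    expand = ℕ-Solver.solve-∀
    coords-* : mk (+ u) (+ v) * mk (+ u′) (+ v′)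
               ≡ mk (+ (u ℕ.* u′ ℕ.+ v ℕ.* v′)) (+ (u ℕ.* v′ ℕ.+ v ℕ.* u′ ℕ.+ a ℕ.* (v ℕ.* v′)))
    coords-* = sym (cong₂ mk
      (trans (ℤ.pos-+ (u ℕ.* u′) (v ℕ.* v′)) (cong₂ ℤ._+_ (ℤ.pos-* u u′) (ℤ.pos-* v v′)))
      (trans (ℤ.pos-+ (u ℕ.* v′ ℕ.+ v ℕ.* u′) (a ℕ.* (v ℕ.* v′)))
        (cong₂ ℤ._+_ (trans (ℤ.pos-+ (u ℕ.* v′) (v ℕ.* u′)) (cong₂ ℤ._+_ (ℤ.pos-* u v′) (ℤ.pos-* v u′)))
                     (trans (ℤ.pos-* a (v ℕ.* v′)) (cong (A ℤ.*_) (ℤ.pos-* v v′))))))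

  data Positive (x : Zθ) : Set where
    positive : ∀ j {X} → ℕ[θ]⁺ X → x ≡ θ^ a j * X → Positive x

  data NonNegative (x : Zθ) : Set where
    nonNeg-zero : x ≡ zeroθ → NonNegative x
    nonNeg-pos : Positive x → NonNegative x

  ≤⇒+ℕ : ∀ {j l} → j ℤ.≤ l → Σ[ d ∈ ℕ ] l ≡ j ℤ.+ + d
  ≤⇒+ℕ {j} {l} j≤l = ℤ.∣ l ℤ.- j ∣ , (begin
    l                   ≡⟨ split j l ⟩
    j ℤ.+ (l ℤ.- j)     ≡⟨ cong (λ z → j ℤ.+ z) (ℤ.0≤i⇒+∣i∣≡i (ℤ.i≤j⇒0≤j-i j≤l)) ⟨
    j ℤ.+ + ℤ.∣ l ℤ.- j ∣ ∎)
    where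
    open ≡-Reasoning
    split : ∀ j l → l ≡ j ℤ.+ (l ℤ.- j)
    split = ℤ-Solver.solve-∀

  private
    positive-+-≤ : ∀ {j l X Y} → j ℤ.≤ l → ℕ[θ]⁺ X → ℕ[θ]⁺ Y → Positive (θ^ a j * X + θ^ a l * Y)
    positive-+-≤ {j} {l} {X} {Y} j≤l X⁺ Y⁺ with ≤⇒+ℕ j≤l
    ... | d , refl = positive j (ℕ[θ]⁺-+ X⁺ (ℕ[θ]⁺-θ^ d Y⁺)) (begin
      θ^ a j * X + θ^ a (j ℤ.+ + d) * Y           ≡⟨ cong (λ z → θ^ a j * X + z * Y) (θ^-+ j (+ d)) ⟩
      θ^ a j * X + θ^ a j * θ^ a (+ d) * Y
        ≡⟨ solve 4 (λ P Q X Y → P :* X :+ P :* Q :* Y := P :* (X :+ Q :* Y)) refl (θ^ a j) (θ^ a (+ d)) X Y ⟩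
      θ^ a j * (X + θ^ a (+ d) * Y)               ∎)
      where open ≡-Reasoning

  positive-+ : ∀ {x y} → Positive x → Positive y → Positive (x + y)
  positive-+ (positive j {X} X⁺ refl) (positive l {Y} Y⁺ refl) with ℤ.≤-total j l
  ... | inj₁ j≤l = positive-+-≤ j≤l X⁺ Y⁺
  ... | inj₂ l≤j = subst Positive (+-comm (θ^ a l * Y) (θ^ a j * X)) (positive-+-≤ l≤j Y⁺ X⁺)

  positive-* : ∀ {x y} → Positive x → Positive y → Positive (x * y)
  positive-* (positive j {X} X⁺ refl) (positive l {Y} Y⁺ refl) = positive (j ℤ.+ l) (ℕ[θ]⁺-* X⁺ Y⁺) (begin
    θ^ a j * X * (θ^ a l * Y)       ≡⟨ solve 4 (λ P X Q Y → P :* X :* (Q :* Y) := P :* Q :* (X :* Y))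
                                         refl (θ^ a j) X (θ^ a l) Y ⟩
    θ^ a j * θ^ a l * (X * Y)       ≡⟨ cong (_* (X * Y)) (θ^-+ j l) ⟨
    θ^ a (j ℤ.+ l) * (X * Y)        ∎)
    where open ≡-Reasoning

  positive-θ^ : ∀ j → Positive (θ^ a j)
  positive-θ^ j = positive j (coords 1 0 ℕ.≤-refl) (sym (*-identityʳ (θ^ a j)))

  positive-fromℕ : ∀ n → Positive (fromℕθ (suc n))
  positive-fromℕ n = positive (+ 0) (coords (suc n) 0 (s≤s z≤n)) (sym (*-identityˡ (fromℕθ (suc n))))

  nonNegative-fromℕ : ∀ n → NonNegative (fromℕθ n)
  nonNegative-fromℕ zero = nonNeg-zero refl
  nonNegative-fromℕ (suc n) = nonNeg-pos (positive-fromℕ n)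

  ¬positive-zero : ¬ Positive zeroθ
  ¬positive-zero (positive j {X} (coords u v 1≤u+v) 0≡θ^j*X) =
    ℕ.<⇒≢ 1≤u+v (sym (cong (λ X → ℤ.∣ re X ∣ ℕ.+ ℤ.∣ im X ∣) X≡0))
    where
    X≡0 : X ≡ zeroθ
    X≡0 = begin
      X                             ≡⟨ *-identityˡ X ⟨
      oneθ * X                      ≡⟨ cong (λ e → θ^ a e * X) (ℤ.+-inverseˡ j) ⟨
      θ^ a (ℤ.- j ℤ.+ j) * X        ≡⟨ cong (_* X) (θ^-+ (ℤ.- j) j) ⟩
      θ^ a (ℤ.- j) * θ^ a j * X     ≡⟨ *-assoc (θ^ a (ℤ.- j)) (θ^ a j) X ⟩
      θ^ a (ℤ.- j) * (θ^ a j * X)   ≡⟨ cong (θ^ a (ℤ.- j) *_) 0≡θ^j*X ⟨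
      θ^ a (ℤ.- j) * zeroθ          ≡⟨ zeroʳ (θ^ a (ℤ.- j)) ⟩
      zeroθ                         ∎
      where open ≡-Reasoning

  positive-+-nonNeg : ∀ {x y} → Positive x → NonNegative y → Positive (x + y)
  positive-+-nonNeg {x} x⁺ (nonNeg-zero refl) = subst Positive (sym (+-identityʳ x)) x⁺
  positive-+-nonNeg x⁺ (nonNeg-pos y⁺) = positive-+ x⁺ y⁺

  nonNeg-+-positive : ∀ {x y} → NonNegative x → Positive y → Positive (x + y)
  nonNeg-+-positive {x} {y} x⁰ y⁺ = subst Positive (+-comm y x) (positive-+-nonNeg y⁺ x⁰)

  nonNeg-+ : ∀ {x y} → NonNegative x → NonNegative y → NonNegative (x + y)
  nonNeg-+ {y = y} (nonNeg-zero refl) y⁰ = subst NonNegative (sym (+-identityˡ y)) y⁰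
  nonNeg-+ (nonNeg-pos x⁺) y⁰ = nonNeg-pos (positive-+-nonNeg x⁺ y⁰)

  nonNeg-* : ∀ {x y} → NonNegative x → NonNegative y → NonNegative (x * y)
  nonNeg-* {y = y} (nonNeg-zero refl) _ = nonNeg-zero (zeroˡ y)
  nonNeg-* {x} (nonNeg-pos _) (nonNeg-zero refl) = nonNeg-zero (zeroʳ x)
  nonNeg-* (nonNeg-pos x⁺) (nonNeg-pos y⁺) = nonNeg-pos (positive-* x⁺ y⁺)

  infix 4 _<θ_ _≤θ_

  record _<θ_ (x y : Zθ) : Set where
    constructor <θ-intro
    field <θ⇒positive : Positive (y - x)

  record _≤θ_ (x y : Zθ) : Set where
    constructor ≤θ-intro
    field ≤θ⇒nonNeg : NonNegative (y - x)

  open _<θ_ public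
  open _≤θ_ public

  private
    difference-chain : ∀ x y z → z - x ≡ (z - y) + (y - x)
    difference-chain = solve 3 (λ x y z → z :- x := (z :- y) :+ (y :- x)) refl

  <θ⇒≤θ : ∀ {x y} → x <θ y → x ≤θ y
  <θ⇒≤θ (<θ-intro d⁺) = ≤θ-intro (nonNeg-pos d⁺)

  ≤θ-refl : ∀ x → x ≤θ x
  ≤θ-refl x = ≤θ-intro (nonNeg-zero (-‿inverseʳ x))

  ≤θ-trans : ∀ {x y z} → x ≤θ y → y ≤θ z → x ≤θ z
  ≤θ-trans {x} {y} {z} (≤θ-intro d⁰) (≤θ-intro e⁰) =
    ≤θ-intro (subst NonNegative (sym (difference-chain x y z)) (nonNeg-+ e⁰ d⁰))

  <θ-≤θ-trans : ∀ {x y z} → x <θ y → y ≤θ z → x <θ z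
  <θ-≤θ-trans {x} {y} {z} (<θ-intro d⁺) (≤θ-intro e⁰) =
    <θ-intro (subst Positive (sym (difference-chain x y z)) (nonNeg-+-positive e⁰ d⁺))

  ≤θ-<θ-trans : ∀ {x y z} → x ≤θ y → y <θ z → x <θ z
  ≤θ-<θ-trans {x} {y} {z} (≤θ-intro d⁰) (<θ-intro e⁺) =
    <θ-intro (subst Positive (sym (difference-chain x y z)) (positive-+-nonNeg e⁺ d⁰))

  <θ⇒≱θ : ∀ {x y} → x <θ y → ¬ (y ≤θ x)
  <θ⇒≱θ {x} {y} (<θ-intro d⁺) (≤θ-intro e⁰) =
    ¬positive-zero (subst Positive (trans (sym (difference-chain x y x)) (-‿inverseʳ x)) (nonNeg-+-positive e⁰ d⁺))

  positive-≤θ : ∀ {x y} → Positive x → x ≤θ y → Positive y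
  positive-≤θ {x} {y} x⁺ (≤θ-intro d⁰) =
    subst Positive (solve 2 (λ x y → x :+ (y :- x) := y) refl x y) (positive-+-nonNeg x⁺ d⁰)

  private
    *-distribˡ-difference : ∀ c x y → c * y - c * x ≡ c * (y - x)
    *-distribˡ-difference = solve 3 (λ c x y → c :* y :- c :* x := c :* (y :- x)) refl

  *-monoˡ-<θ : ∀ {c x y} → Positive c → x <θ y → c * x <θ c * y
  *-monoˡ-<θ {c} {x} {y} c⁺ (<θ-intro d⁺) =
    <θ-intro (subst Positive (sym (*-distribˡ-difference c x y)) (positive-* c⁺ d⁺))

  *-monoˡ-≤θ : ∀ {c x y} → Positive c → x ≤θ y → c * x ≤θ c * y
  *-monoˡ-≤θ {c} {x} {y} c⁺ (≤θ-intro d⁰) =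
    ≤θ-intro (subst NonNegative (sym (*-distribˡ-difference c x y)) (nonNeg-* (nonNeg-pos c⁺) d⁰))

  *-mono-≤θ : ∀ {l₁ l₂ x₁ x₂} → Positive l₁ → Positive l₂ → l₁ ≤θ x₁ → l₂ ≤θ x₂ → l₁ * l₂ ≤θ x₁ * x₂
  *-mono-≤θ {l₁} {l₂} {x₁} {x₂} l₁⁺ l₂⁺ l₁≤x₁@(≤θ-intro d₁⁰) (≤θ-intro d₂⁰) = ≤θ-intro (subst NonNegative
    (solve 4 (λ l₁ l₂ x₁ x₂ → x₁ :* (x₂ :- l₂) :+ l₂ :* (x₁ :- l₁) := x₁ :* x₂ :- l₁ :* l₂) refl l₁ l₂ x₁ x₂)
    (nonNeg-+ (nonNeg-* (nonNeg-pos (positive-≤θ l₁⁺ l₁≤x₁)) d₂⁰) (nonNeg-* (nonNeg-pos l₂⁺) d₁⁰)))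

  ≤θ-isPreorder : IsPreorder _≡_ _≤θ_
  ≤θ-isPreorder = record
    { isEquivalence = isEquivalence
    ; reflexive = λ { refl → ≤θ-refl _ }
    ; trans = ≤θ-trans
    }

  <θ-asym : Asymmetric _<θ_
  <θ-asym x<y y<x = <θ⇒≱θ x<y (<θ⇒≤θ y<x)

  <θ-trans : Transitive _<θ_
  <θ-trans x<y y<z = <θ-≤θ-trans x<y (<θ⇒≤θ y<z)

  <θ-resp-≡ : _<θ_ Respects₂ _≡_
  <θ-resp-≡ = (λ { refl x<y → x<y }) , (λ { refl x<y → x<y })

  module ≤θ-Reasoning = Triple ≤θ-isPreorder <θ-asym <θ-trans <θ-resp-≡ <θ⇒≤θ <θ-≤θ-trans ≤θ-<θ-trans

  θ-split : ∀ b c → b ℕ.+ c ≡ a → θ̂ ≡ fromℕθ b + fromℕθ c + θ⁻¹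
  θ-split b c b+c≡a = trans (cong₂ mk (sym (ℤ.+-inverseʳ A)) refl) (cong (λ n → fromℕθ n + θ⁻¹) (sym b+c≡a))

  positive-θ : Positive θ̂
  positive-θ = subst Positive (*-identityʳ θ̂) (positive-θ^ (+ 1))

  positive-θ⁻¹ : Positive θ⁻¹
  positive-θ⁻¹ = subst Positive (*-identityʳ θ⁻¹) (positive-θ^ -[1+ 0 ])

  positive-ℕ+θ⁻¹* : ∀ n {y} → Positive y → Positive (fromℕθ n + θ⁻¹ * y)
  positive-ℕ+θ⁻¹* n y⁺ = nonNeg-+-positive (nonNegative-fromℕ n) (positive-* positive-θ⁻¹ y⁺)

  1<θ : 1 ℕ.≤ a → oneθ <θ θ̂
  1<θ 1≤a = <θ-intro (subst Positive (sym θ-1) (positive-ℕ+θ⁻¹* (ℕ.pred a) (positive-fromℕ 0)))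
    where
    θ-1 : θ̂ - oneθ ≡ fromℕθ (ℕ.pred a) + θ⁻¹ * oneθ
    θ-1 = begin
      θ̂ - oneθ
        ≡⟨ cong (_- oneθ) (θ-split 1 (ℕ.pred a) (ℕ.suc-pred a {{ℕ.>-nonZero 1≤a}})) ⟩
      oneθ + fromℕθ (ℕ.pred a) + θ⁻¹ - oneθ
        ≡⟨ solve 2 (λ n i → con (+ 1) :+ n :+ i :- con (+ 1) := n :+ i :* con (+ 1)) refl (fromℕθ (ℕ.pred a)) θ⁻¹ ⟩
      fromℕθ (ℕ.pred a) + θ⁻¹ * oneθ
        ∎
      where open ≡-Reasoning

  1≤θ^ : 1 ℕ.≤ a → ∀ d → oneθ ≤θ θ^ a (+ d)
  1≤θ^ 1≤a zero = ≤θ-refl oneθ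
  1≤θ^ 1≤a (suc d) = ≤θ-trans (<θ⇒≤θ (1<θ 1≤a))
    (subst (_≤θ θ^ a (+ suc d)) (*-identityʳ θ̂) (*-monoˡ-≤θ positive-θ (1≤θ^ 1≤a d)))

  θ^-mono-≤ : 1 ℕ.≤ a → ∀ {e f} → e ℤ.≤ f → θ^ a e ≤θ θ^ a f
  θ^-mono-≤ 1≤a {e} e≤f with ≤⇒+ℕ e≤f
  ... | d , refl = subst₂ _≤θ_ (*-identityʳ (θ^ a e)) (sym (θ^-+ e (+ d)))
                     (*-monoˡ-≤θ (positive-θ^ e) (1≤θ^ 1≤a d))

  θ^-cancel-< : 1 ℕ.≤ a → ∀ {e f} → θ^ a e <θ θ^ a f → e ℤ.< f
  θ^-cancel-< 1≤a {e} {f} θ^e<θ^f with f ℤ.≤? e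
  ... | yes f≤e = ⊥-elim (<θ⇒≱θ θ^e<θ^f (θ^-mono-≤ 1≤a f≤e))
  ... | no f≰e = ℤ.≰⇒> f≰e

  open CoordinateSigns a using (PositiveCoords; PositiveCoords-θ⁻¹; PositiveCoords⇒Pos)

  private
    HasPositiveCoords : Zθ → Set
    HasPositiveCoords x = PositiveCoords (re x) (im x)

    ℕ[θ]⁺⇒PositiveCoords : ∀ {X} → ℕ[θ]⁺ X → HasPositiveCoords X
    ℕ[θ]⁺⇒PositiveCoords (coords zero v 1≤v) = inj₁ (+≤+ z≤n , +≤+ z≤n , inj₂ (+<+ 1≤v))
    ℕ[θ]⁺⇒PositiveCoords (coords (suc u) v _) = inj₁ (+≤+ z≤n , +≤+ z≤n , inj₁ (+<+ (s≤s z≤n)))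

    PositiveCoords-θ⁻¹* : ∀ {x} → HasPositiveCoords x → HasPositiveCoords (θ⁻¹ * x)
    PositiveCoords-θ⁻¹* {x} x⁺ = subst HasPositiveCoords (sym (θ⁻¹*-coords (re x) (im x))) (PositiveCoords-θ⁻¹ x⁺)

    PositiveCoords-θ^-[1+] : ∀ n {x} → HasPositiveCoords x → HasPositiveCoords (θ^ a -[1+ n ] * x)
    PositiveCoords-θ^-[1+] zero {x} x⁺ =
      subst HasPositiveCoords (cong (_* x) (sym (*-identityʳ θ⁻¹))) (PositiveCoords-θ⁻¹* x⁺)
    PositiveCoords-θ^-[1+] (suc n) {x} x⁺ = subst HasPositiveCoords (sym (*-assoc θ⁻¹ (θ^ a -[1+ n ]) x))
      (PositiveCoords-θ⁻¹* (PositiveCoords-θ^-[1+] n x⁺))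

  positive⇒Pos : ∀ {x} → Positive x → Pos a x
  positive⇒Pos (positive (+ d) X⁺ refl) = PositiveCoords⇒Pos (ℕ[θ]⁺⇒PositiveCoords (ℕ[θ]⁺-θ^ d X⁺))
  positive⇒Pos (positive -[1+ n ] X⁺ refl) =
    PositiveCoords⇒Pos (PositiveCoords-θ^-[1+] n (ℕ[θ]⁺⇒PositiveCoords X⁺))

  ≤θ⇒Leθ : ∀ {x y} → x ≤θ y → Leθ a x y
  ≤θ⇒Leθ {x} {y} (≤θ-intro (nonNeg-zero y-x≡0)) = inj₁ (begin
    x              ≡⟨ solve 2 (λ x y → x := y :- (y :- x)) refl x y ⟩
    y - (y - x)    ≡⟨ cong (λ d → y - d) y-x≡0 ⟩
    y - zeroθ      ≡⟨ solve 1 (λ y → y :- con (+ 0) := y) refl y ⟩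
    y              ∎)
    where open ≡-Reasoning
  ≤θ⇒Leθ (≤θ-intro (nonNeg-pos y-x⁺)) = inj₂ (positive⇒Pos y-x⁺)

  -- The Galois conjugation θ ↦ a − θ = −θ⁻¹.
  σ : Zθ → Zθ
  σ (mk u v) = mk (u ℤ.+ A ℤ.* v) (ℤ.- v)

  σ-+ : ∀ x y → σ (x + y) ≡ σ x + σ y
  σ-+ (mk u v) (mk u′ v′) = cong₂ mk (re-eq A u v u′ v′) (ℤ.neg-distrib-+ v v′)
    where
    re-eq : ∀ A u v u′ v′ → (u ℤ.+ u′) ℤ.+ A ℤ.* (v ℤ.+ v′) ≡ (u ℤ.+ A ℤ.* v) ℤ.+ (u′ ℤ.+ A ℤ.* v′)
    re-eq = ℤ-Solver.solve-∀

  σ-* : ∀ x y → σ (x * y) ≡ σ x * σ y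
  σ-* (mk u v) (mk u′ v′) = cong₂ mk (re-eq A u v u′ v′) (im-eq A u v u′ v′)
    where
    re-eq : ∀ A u v u′ v′ → (u ℤ.* u′ ℤ.+ v ℤ.* v′) ℤ.+ A ℤ.* (u ℤ.* v′ ℤ.+ v ℤ.* u′ ℤ.+ A ℤ.* (v ℤ.* v′))
                            ≡ (u ℤ.+ A ℤ.* v) ℤ.* (u′ ℤ.+ A ℤ.* v′) ℤ.+ (ℤ.- v) ℤ.* (ℤ.- v′)
    re-eq = ℤ-Solver.solve-∀
    im-eq : ∀ A u v u′ v′ → ℤ.- (u ℤ.* v′ ℤ.+ v ℤ.* u′ ℤ.+ A ℤ.* (v ℤ.* v′))
                            ≡ (u ℤ.+ A ℤ.* v) ℤ.* (ℤ.- v′) ℤ.+ (ℤ.- v) ℤ.* (u′ ℤ.+ A ℤ.* v′)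
                              ℤ.+ A ℤ.* ((ℤ.- v) ℤ.* (ℤ.- v′))
    im-eq = ℤ-Solver.solve-∀

  σ-neg : ∀ x → σ (- x) ≡ - σ x
  σ-neg (mk u v) = cong₂ mk (re-eq A u v) refl
    where
    re-eq : ∀ A u v → ℤ.- u ℤ.+ A ℤ.* (ℤ.- v) ≡ ℤ.- (u ℤ.+ A ℤ.* v)
    re-eq = ℤ-Solver.solve-∀

  σ-fromℕ : ∀ n → σ (fromℕθ n) ≡ fromℕθ n
  σ-fromℕ n = cong₂ mk (re-eq A (+ n)) refl
    where
    re-eq : ∀ A u → u ℤ.+ A ℤ.* + 0 ≡ u
    re-eq = ℤ-Solver.solve-∀

  σ-θ : σ θ̂ ≡ - θ⁻¹
  σ-θ = cong₂ mk (re-eq A) refl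
    where
    re-eq : ∀ A → + 0 ℤ.+ A ℤ.* + 1 ≡ ℤ.- (ℤ.- A)
    re-eq = ℤ-Solver.solve-∀

  σ-θ⁻¹ : σ θ⁻¹ ≡ - θ̂
  σ-θ⁻¹ = cong₂ mk (re-eq A) refl
    where
    re-eq : ∀ A → ℤ.- A ℤ.+ A ℤ.* + 1 ≡ ℤ.- + 0
    re-eq = ℤ-Solver.solve-∀

  infix 4 _≈±_

  data _≈±_ (x y : Zθ) : Set where
    ≈+ : x ≡ y → x ≈± y
    ≈- : x ≡ - y → x ≈± y

  -x≈±x : ∀ x → - x ≈± x
  -x≈±x x = ≈- refl

  ≈±-neg : ∀ {x y} → x ≈± y → - x ≈± y
  ≈±-neg (≈+ refl) = ≈- refl
  ≈±-neg {y = y} (≈- refl) = ≈+ (solve 1 (λ y → :- (:- y) := y) refl y)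

  ≈±-sym : ∀ {x y} → x ≈± y → y ≈± x
  ≈±-sym (≈+ refl) = ≈+ refl
  ≈±-sym {y = y} (≈- refl) = ≈- (solve 1 (λ y → y := :- (:- y)) refl y)

  ≈±-trans : ∀ {x y z} → x ≈± y → y ≈± z → x ≈± z
  ≈±-trans (≈+ refl) y≈±z = y≈±z
  ≈±-trans (≈- refl) y≈±z = ≈±-neg y≈±z

  ≈±-* : ∀ {x y x′ y′} → x ≈± y → x′ ≈± y′ → x * x′ ≈± y * y′
  ≈±-* (≈+ refl) (≈+ refl) = ≈+ refl
  ≈±-* {y = y} {y′ = y′} (≈+ refl) (≈- refl) = ≈- (solve 2 (λ y y′ → y :* (:- y′) := :- (y :* y′)) refl y y′)
  ≈±-* {y = y} {y′ = y′} (≈- refl) (≈+ refl) = ≈- (solve 2 (λ y y′ → (:- y) :* y′ := :- (y :* y′)) refl y y′)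
  ≈±-* {y = y} {y′ = y′} (≈- refl) (≈- refl) = ≈+ (solve 2 (λ y y′ → (:- y) :* (:- y′) := y :* y′) refl y y′)

  ≈±-zero : ∀ {y} → zeroθ ≈± y → y ≡ zeroθ
  ≈±-zero (≈+ 0≡y) = sym 0≡y
  ≈±-zero {y} (≈- 0≡-y) = begin
    y        ≡⟨ solve 1 (λ y → y := :- (:- y)) refl y ⟩
    - (- y)  ≡⟨ cong -_ 0≡-y ⟨
    - zeroθ  ≡⟨⟩
    zeroθ    ∎
    where open ≡-Reasoning

  zero*≈±-¬positive : ∀ s {y} → zeroθ * s ≈± y → ¬ Positive y
  zero*≈±-¬positive s {y} 0s≈±y y⁺ = ¬positive-zero (subst Positive (≈±-zero (subst (_≈± y) (zeroˡ s) 0s≈±y)) y⁺)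

  ≈±-positive : ∀ {x y} → x ≈± y → Positive x → Positive y → x ≡ y
  ≈±-positive (≈+ x≡y) _ _ = x≡y
  ≈±-positive {y = y} (≈- refl) -y⁺ y⁺ =
    ⊥-elim (¬positive-zero (subst Positive (-‿inverseˡ y) (positive-+ -y⁺ y⁺)))

  σ-θ^-suc : ∀ e → σ (θ^ a (ℤ.suc e)) ≡ - θ⁻¹ * σ (θ^ a e)
  σ-θ^-suc e = trans (cong σ (θ^-suc e)) (trans (σ-* θ̂ (θ^ a e)) (cong (_* σ (θ^ a e)) σ-θ))

  σ-θ^-pred : ∀ e → σ (θ^ a (ℤ.pred e)) ≡ - θ̂ * σ (θ^ a e)
  σ-θ^-pred e = trans (cong σ (θ^-pred e)) (trans (σ-* θ⁻¹ (θ^ a e)) (cong (_* σ (θ^ a e)) σ-θ⁻¹))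

  σ-θ^ : ∀ e → σ (θ^ a e) ≈± θ^ a (ℤ.- e)
  σ-θ^ = ℤ-induction (λ e → σ (θ^ a e) ≈± θ^ a (ℤ.- e)) (≈+ (σ-fromℕ 1)) suc-step pred-step
    where
    suc-step : ∀ e → σ (θ^ a e) ≈± θ^ a (ℤ.- e) → σ (θ^ a (ℤ.suc e)) ≈± θ^ a (ℤ.- ℤ.suc e)
    suc-step e ih = subst₂ _≈±_ (sym (σ-θ^-suc e)) (trans (sym (θ^-pred (ℤ.- e))) (cong (θ^ a) (neg-suc e)))
      (≈±-* (-x≈±x θ⁻¹) ih)
      where
      neg-suc : ∀ e → -[1+ 0 ] ℤ.+ ℤ.- e ≡ ℤ.- (+ 1 ℤ.+ e)
      neg-suc = ℤ-Solver.solve-∀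
    pred-step : ∀ e → σ (θ^ a e) ≈± θ^ a (ℤ.- e) → σ (θ^ a (ℤ.pred e)) ≈± θ^ a (ℤ.- ℤ.pred e)
    pred-step e ih = subst₂ _≈±_ (sym (σ-θ^-pred e)) (trans (sym (θ^-suc (ℤ.- e))) (cong (θ^ a) (neg-pred e)))
      (≈±-* (-x≈±x θ̂) ih)
      where
      neg-pred : ∀ e → + 1 ℤ.+ ℤ.- e ≡ ℤ.- (-[1+ 0 ] ℤ.+ e)
      neg-pred = ℤ-Solver.solve-∀

  σ-digits : List ℕ → Zθ
  σ-digits [] = zeroθ
  σ-digits (b ∷ bs) = fromℕθ b - θ⁻¹ * σ-digits bs

  σ-evalDigits : ∀ m bs → σ (evalDigits a m bs) ≡ σ (θ^ a m) * σ-digits bs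
  σ-evalDigits m [] = trans (σ-fromℕ 0) (sym (zeroʳ (σ (θ^ a m))))
  σ-evalDigits m (b ∷ bs) = begin
    σ (fromℕθ b * θ^ a m + evalDigits a (m ℤ.+ + 1) bs)
      ≡⟨ σ-+ (fromℕθ b * θ^ a m) (evalDigits a (m ℤ.+ + 1) bs) ⟩
    σ (fromℕθ b * θ^ a m) + σ (evalDigits a (m ℤ.+ + 1) bs)
      ≡⟨ cong₂ _+_ (trans (σ-* (fromℕθ b) (θ^ a m)) (cong (_* σ (θ^ a m)) (σ-fromℕ b)))
                   (σ-evalDigits (m ℤ.+ + 1) bs) ⟩
    fromℕθ b * σ (θ^ a m) + σ (θ^ a (m ℤ.+ + 1)) * σ-digits bs
      ≡⟨ cong (λ e → fromℕθ b * σ (θ^ a m) + σ (θ^ a e) * σ-digits bs) (ℤ.+-comm m (+ 1)) ⟩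
    fromℕθ b * σ (θ^ a m) + σ (θ^ a (ℤ.suc m)) * σ-digits bs
      ≡⟨ cong (λ z → fromℕθ b * σ (θ^ a m) + z * σ-digits bs) (σ-θ^-suc m) ⟩
    fromℕθ b * σ (θ^ a m) + - θ⁻¹ * σ (θ^ a m) * σ-digits bs
      ≡⟨ solve 4 (λ B S i T → B :* S :+ (:- i) :* S :* T := S :* (B :- i :* T))
                 refl (fromℕθ b) (σ (θ^ a m)) θ⁻¹ (σ-digits bs) ⟩
    σ (θ^ a m) * (fromℕθ b - θ⁻¹ * σ-digits bs)
      ∎
    where open ≡-Reasoning

  σ-digits-bounds : ∀ bs → DigitsLe a bs → - oneθ <θ σ-digits bs × σ-digits bs <θ θ̂
  σ-digits-bounds [] _ = <θ-intro (positive-fromℕ 0) , <θ-intro (subst Positive (sym (+-identityʳ θ̂)) positive-θ)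
  σ-digits-bounds (b ∷ bs) (b≤a , bs≤a) =
    <θ-intro (subst Positive above-eq (positive-ℕ+θ⁻¹* b (<θ⇒positive (proj₂ IH)))) ,
    <θ-intro (subst Positive below-eq (positive-ℕ+θ⁻¹* c (<θ⇒positive (proj₁ IH))))
    where
    IH = σ-digits-bounds bs bs≤a
    open ≡-Reasoning
    T = σ-digits bs
    c = a ℕ.∸ b
    above-eq : fromℕθ b + θ⁻¹ * (θ̂ - T) ≡ σ-digits (b ∷ bs) - - oneθ
    above-eq = begin
      fromℕθ b + θ⁻¹ * (θ̂ - T)
        ≡⟨ solve 4 (λ B i θ T → B :+ i :* (θ :- T) := (B :- i :* T) :- :- (i :* θ)) refl (fromℕθ b) θ⁻¹ θ̂ T ⟩
      (fromℕθ b - θ⁻¹ * T) - - (θ⁻¹ * θ̂)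
        ≡⟨ cong (λ z → (fromℕθ b - θ⁻¹ * T) - - z) θ⁻¹*θ ⟩
      σ-digits (b ∷ bs) - - oneθ
        ∎
    below-eq : fromℕθ c + θ⁻¹ * (T - - oneθ) ≡ θ̂ - σ-digits (b ∷ bs)
    below-eq = begin
      fromℕθ c + θ⁻¹ * (T - - oneθ)
        ≡⟨ solve 4 (λ B C i T → C :+ i :* (T :- :- con (+ 1)) := B :+ C :+ i :- (B :- i :* T))
                   refl (fromℕθ b) (fromℕθ c) θ⁻¹ T ⟩
      fromℕθ b + fromℕθ c + θ⁻¹ - σ-digits (b ∷ bs)
        ≡⟨ cong (_- σ-digits (b ∷ bs)) (θ-split b c (ℕ.m+[n∸m]≡n b≤a)) ⟨
      θ̂ - σ-digits (b ∷ bs)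
        ∎

  σ-digits-<θ-1 : 1 ℕ.≤ a → ∀ bs → DigitsLe a bs → head bs ≢ just a → σ-digits bs <θ θ̂ - oneθ
  σ-digits-<θ-1 1≤a [] _ _ = <θ-intro (subst Positive (sym (+-identityʳ (θ̂ - oneθ))) (<θ⇒positive (1<θ 1≤a)))
  σ-digits-<θ-1 1≤a (b ∷ bs) (b≤a , bs≤a) b≢a =
    <θ-intro (subst Positive below-eq (positive-ℕ+θ⁻¹* c (<θ⇒positive (proj₁ (σ-digits-bounds bs bs≤a)))))
    where
    open ≡-Reasoning
    T = σ-digits bs
    b<a : b ℕ.< a
    b<a = ℕ.≤∧≢⇒< b≤a (λ b≡a → b≢a (cong just b≡a))
    c = a ℕ.∸ suc b
    b+1+c≡a : b ℕ.+ suc c ≡ a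
    b+1+c≡a = trans (ℕ.+-suc b c) (ℕ.m+[n∸m]≡n b<a)
    below-eq : fromℕθ c + θ⁻¹ * (T - - oneθ) ≡ θ̂ - oneθ - σ-digits (b ∷ bs)
    below-eq = begin
      fromℕθ c + θ⁻¹ * (T - - oneθ)
        ≡⟨ solve 4 (λ B C i T → C :+ i :* (T :- :- con (+ 1))
                                := B :+ (con (+ 1) :+ C) :+ i :- con (+ 1) :- (B :- i :* T))
                   refl (fromℕθ b) (fromℕθ c) θ⁻¹ T ⟩
      fromℕθ b + fromℕθ (suc c) + θ⁻¹ - oneθ - σ-digits (b ∷ bs)
        ≡⟨ cong (λ θ′ → θ′ - oneθ - σ-digits (b ∷ bs)) (θ-split b (suc c) b+1+c≡a) ⟨
      θ̂ - oneθ - σ-digits (b ∷ bs)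
        ∎

  greedy-head : ∀ {c} bs → GreedyAdj a (suc c ∷ bs) → head bs ≢ just a
  greedy-head [] _ ()
  greedy-head (d ∷ ds) (d≡a⇒1+c≡0 , _) refl = ℕ.1+n≢0 (d≡a⇒1+c≡0 refl)

  θ⁻¹<σ-digits : 1 ℕ.≤ a → ∀ c bs → DigitsLe a bs → GreedyAdj a (suc c ∷ bs) → θ⁻¹ <θ σ-digits (suc c ∷ bs)
  θ⁻¹<σ-digits 1≤a c bs bs≤a greedy = <θ-intro (subst Positive above-eq
    (positive-ℕ+θ⁻¹* c (<θ⇒positive (σ-digits-<θ-1 1≤a bs bs≤a (greedy-head bs greedy)))))
    where
    open ≡-Reasoning
    T = σ-digits bs
    above-eq : fromℕθ c + θ⁻¹ * (θ̂ - oneθ - T) ≡ σ-digits (suc c ∷ bs) - θ⁻¹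
    above-eq = begin
      fromℕθ c + θ⁻¹ * (θ̂ - oneθ - T)
        ≡⟨ solve 4 (λ C i θ T → C :+ i :* (θ :- con (+ 1) :- T)
                                := (con (+ 1) :+ C :- i :* T) :- i :+ (i :* θ :- con (+ 1)))
                   refl (fromℕθ c) θ⁻¹ θ̂ T ⟩
      σ-digits (suc c ∷ bs) - θ⁻¹ + (θ⁻¹ * θ̂ - oneθ)
        ≡⟨ cong (λ z → σ-digits (suc c ∷ bs) - θ⁻¹ + (z - oneθ)) θ⁻¹*θ ⟩
      σ-digits (suc c ∷ bs) - θ⁻¹ + (oneθ - oneθ)
        ≡⟨ solve 1 (λ x → x :+ (con (+ 1) :- con (+ 1)) := x) refl (σ-digits (suc c ∷ bs) - θ⁻¹) ⟩
      σ-digits (suc c ∷ bs) - θ⁻¹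
        ∎

  data ZeroOrPower (r : Zθ) : Set where
    is-zero : r ≡ zeroθ → ZeroOrPower r
    is-power : ∀ e → r ≡ θ^ a e → ZeroOrPower r

  record ConjugateFactorisation (x r : Zθ) : Set where
    constructor factorisation
    field
      zeroOrPower : ZeroOrPower r
      cofactor : Zθ
      θ⁻¹<cofactor : θ⁻¹ <θ cofactor
      cofactor<θ : cofactor <θ θ̂
      σ≈±*cofactor : σ x ≈± r * cofactor

  infranorm-factorisation : 1 ℕ.≤ a → ∀ {x r} → IsInfranorm a x r → ConjugateFactorisation x r
  infranorm-factorisation 1≤a (inj₁ (refl , refl)) =
    factorisation (is-zero refl) oneθ θ⁻¹<1 (1<θ 1≤a) (≈+ (trans (σ-fromℕ 0) (sym (zeroˡ oneθ))))
    where
    θ⁻¹<1 : θ⁻¹ <θ oneθ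
    θ⁻¹<1 = subst₂ _<θ_ (*-identityʳ θ⁻¹) θ⁻¹*θ (*-monoˡ-<θ positive-θ⁻¹ (1<θ 1≤a))
  infranorm-factorisation 1≤a (inj₂ (m , zero ∷ bs , (0≢0 , _) , _)) = ⊥-elim (0≢0 refl)
  infranorm-factorisation 1≤a {x} {r}
    (inj₂ (m , suc c ∷ bs , (_ , digits≤a@(_ , bs≤a) , greedy , x≡±eval) , r≡θ^-m)) =
    factorisation (is-power (ℤ.- m) r≡θ^-m) (σ-digits (suc c ∷ bs)) (θ⁻¹<σ-digits 1≤a c bs bs≤a greedy)
      (proj₂ (σ-digits-bounds (suc c ∷ bs) digits≤a)) (σx≈±rT x≡±eval)
    where
    eval = evalDigits a m (suc c ∷ bs)
    σeval≈±rT : σ eval ≈± r * σ-digits (suc c ∷ bs)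
    σeval≈±rT = subst₂ _≈±_ (sym (σ-evalDigits m (suc c ∷ bs))) (cong (_* σ-digits (suc c ∷ bs)) (sym r≡θ^-m))
                  (≈±-* (σ-θ^ m) (≈+ refl))
    σx≈±rT : x ≡ eval ⊎ x ≡ - eval → σ x ≈± r * σ-digits (suc c ∷ bs)
    σx≈±rT (inj₁ refl) = σeval≈±rT
    σx≈±rT (inj₂ refl) = subst (_≈± _) (sym (σ-neg eval)) (≈±-neg σeval≈±rT)

  prod-* : ∀ k (x y : Fin k → Zθ) → prodθ a k (λ i → x i * y i) ≡ prodθ a k x * prodθ a k y
  prod-* zero x y = sym (*-identityˡ oneθ)
  prod-* (suc k) x y = begin
    x₀ * y₀ * prodθ a k (λ i → x (Fin.suc i) * y (Fin.suc i))
      ≡⟨ cong (x₀ * y₀ *_) (prod-* k (x ∘ Fin.suc) (y ∘ Fin.suc)) ⟩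
    x₀ * y₀ * (X * Y)
      ≡⟨ solve 4 (λ x y X Y → x :* y :* (X :* Y) := x :* X :* (y :* Y)) refl x₀ y₀ X Y ⟩
    x₀ * X * (y₀ * Y)
      ∎
    where
    open ≡-Reasoning
    x₀ = x Fin.zero
    y₀ = y Fin.zero
    X = prodθ a k (x ∘ Fin.suc)
    Y = prodθ a k (y ∘ Fin.suc)

  σ-prod : ∀ k x → σ (prodθ a k x) ≡ prodθ a k (σ ∘ x)
  σ-prod zero x = σ-fromℕ 1
  σ-prod (suc k) x =
    trans (σ-* (x Fin.zero) (prodθ a k (x ∘ Fin.suc))) (cong (σ (x Fin.zero) *_) (σ-prod k (x ∘ Fin.suc)))

  prod-≈± : ∀ k {x y : Fin k → Zθ} → (∀ i → x i ≈± y i) → prodθ a k x ≈± prodθ a k y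
  prod-≈± zero _ = ≈+ refl
  prod-≈± (suc k) x≈±y = ≈±-* (x≈±y Fin.zero) (prod-≈± k (x≈±y ∘ Fin.suc))

  prod-zeroOrPower : ∀ k {r : Fin k → Zθ} → (∀ i → ZeroOrPower (r i)) → ZeroOrPower (prodθ a k r)
  prod-zeroOrPower zero _ = is-power (+ 0) refl
  prod-zeroOrPower (suc k) {r} r∈ with r∈ Fin.zero | prod-zeroOrPower k (r∈ ∘ Fin.suc)
  ... | is-zero r₀≡0 | _ = is-zero (trans (cong (_* R) r₀≡0) (zeroˡ R))
    where R = prodθ a k (r ∘ Fin.suc)
  ... | is-power e _ | is-zero R≡0 = is-zero (trans (cong (r Fin.zero *_) R≡0) (zeroʳ (r Fin.zero)))
  ... | is-power e r₀≡θ^e | is-power f R≡θ^f =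
    is-power (e ℤ.+ f) (trans (cong₂ _*_ r₀≡θ^e R≡θ^f) (sym (θ^-+ e f)))

  prod-bounds : ∀ k (t : Fin k → Zθ) → (∀ i → θ⁻¹ ≤θ t i) → (∀ i → t i ≤θ θ̂) →
                θ^ a (ℤ.- + k) ≤θ prodθ a k t × prodθ a k t ≤θ θ^ a (+ k)
  prod-bounds zero t _ _ = ≤θ-refl oneθ , ≤θ-refl oneθ
  prod-bounds (suc k) t θ⁻¹≤t t≤θ =
    subst (_≤θ prodθ a (suc k) t) θ^-[1+k] (*-mono-≤θ positive-θ⁻¹ (positive-θ^ (ℤ.- + k)) (θ⁻¹≤t Fin.zero) lower) ,
    *-mono-≤θ (positive-≤θ positive-θ⁻¹ (θ⁻¹≤t Fin.zero)) (positive-≤θ (positive-θ^ (ℤ.- + k)) lower)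
              (t≤θ Fin.zero) upper
    where
    lower = proj₁ (prod-bounds k (t ∘ Fin.suc) (θ⁻¹≤t ∘ Fin.suc) (t≤θ ∘ Fin.suc))
    upper = proj₂ (prod-bounds k (t ∘ Fin.suc) (θ⁻¹≤t ∘ Fin.suc) (t≤θ ∘ Fin.suc))
    θ^-[1+k] : θ⁻¹ * θ^ a (ℤ.- + k) ≡ θ^ a -[1+ k ]
    θ^-[1+k] = trans (sym (θ^-pred (ℤ.- + k))) (cong (θ^ a) (sym (ℤ.neg-suc k)))

  power-sandwich : 1 ℕ.≤ a → ∀ e f l h {t Π} → θ⁻¹ <θ t → t <θ θ̂ → θ^ a l ≤θ Π → Π ≤θ θ^ a h →
                   θ^ a f * t ≡ θ^ a e * Π → e ℤ.+ l ℤ.≤ f × f ℤ.≤ e ℤ.+ h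
  power-sandwich 1≤a e f l h {t} {Π} θ⁻¹<t t<θ θ^l≤Π Π≤θ^h θ^f*t≡θ^e*Π = lower , upper
    where
    open ≤θ-Reasoning
    lower : e ℤ.+ l ℤ.≤ f
    lower = subst (e ℤ.+ l ℤ.≤_) (ℤ.pred-suc f) (ℤ.i<j⇒i≤pred[j] (θ^-cancel-< 1≤a {e ℤ.+ l} {ℤ.suc f} (begin-strict
      θ^ a (e ℤ.+ l)      ≡⟨ θ^-+ e l ⟩
      θ^ a e * θ^ a l     ≤⟨ *-monoˡ-≤θ (positive-θ^ e) θ^l≤Π ⟩
      θ^ a e * Π          ≡⟨ θ^f*t≡θ^e*Π ⟨
      θ^ a f * t          <⟨ *-monoˡ-<θ (positive-θ^ f) t<θ ⟩
      θ^ a f * θ̂          ≡⟨ trans (*-comm (θ^ a f) θ̂) (sym (θ^-suc f)) ⟩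
      θ^ a (ℤ.suc f)      ∎)))
    upper : f ℤ.≤ e ℤ.+ h
    upper = subst (ℤ._≤ e ℤ.+ h) (ℤ.suc-pred f) (ℤ.i<j⇒suc[i]≤j (θ^-cancel-< 1≤a {ℤ.pred f} {e ℤ.+ h} (begin-strict
      θ^ a (ℤ.pred f)     ≡⟨ trans (θ^-pred f) (*-comm θ⁻¹ (θ^ a f)) ⟩
      θ^ a f * θ⁻¹        <⟨ *-monoˡ-<θ (positive-θ^ f) θ⁻¹<t ⟩
      θ^ a f * t          ≡⟨ θ^f*t≡θ^e*Π ⟩
      θ^ a e * Π          ≤⟨ *-monoˡ-≤θ (positive-θ^ e) Π≤θ^h ⟩
      θ^ a e * θ^ a h     ≡⟨ θ^-+ e h ⟨
      θ^ a (e ℤ.+ h)      ∎)))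

  zeroOrPower-sandwich : 1 ℕ.≤ a → ∀ {N Q t Π l h} → ZeroOrPower N → ZeroOrPower Q →
                         θ⁻¹ <θ t → t <θ θ̂ → θ^ a l ≤θ Π → Π ≤θ θ^ a h → N * t ≈± Q * Π →
                         θ^ a l * Q ≤θ N × N ≤θ θ^ a h * Q
  zeroOrPower-sandwich 1≤a {l = l} {h} (is-zero refl) (is-zero refl) _ _ _ _ _ =
    subst (_≤θ zeroθ) (sym (zeroʳ (θ^ a l))) (≤θ-refl zeroθ) ,
    subst (zeroθ ≤θ_) (sym (zeroʳ (θ^ a h))) (≤θ-refl zeroθ)
  zeroOrPower-sandwich 1≤a {t = t} {l = l} (is-zero refl) (is-power e refl) _ _ θ^l≤Π _ 0t≈±θ^eΠ =
    ⊥-elim (zero*≈±-¬positive t 0t≈±θ^eΠ (positive-* (positive-θ^ e) (positive-≤θ (positive-θ^ l) θ^l≤Π)))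
  zeroOrPower-sandwich 1≤a {Π = Π} (is-power f refl) (is-zero refl) θ⁻¹<t _ _ _ θ^ft≈±0Π =
    ⊥-elim (zero*≈±-¬positive Π (≈±-sym θ^ft≈±0Π)
      (positive-* (positive-θ^ f) (positive-≤θ positive-θ⁻¹ (<θ⇒≤θ θ⁻¹<t))))
  zeroOrPower-sandwich 1≤a {t = t} {Π} {l} {h} (is-power f refl) (is-power e refl)
                       θ⁻¹<t t<θ θ^l≤Π Π≤θ^h θ^ft≈±θ^eΠ =
    subst (_≤θ θ^ a f) (trans (θ^-+ e l) (*-comm (θ^ a e) (θ^ a l))) (θ^-mono-≤ 1≤a {e ℤ.+ l} {f} e+l≤f) ,
    subst (θ^ a f ≤θ_) (trans (θ^-+ e h) (*-comm (θ^ a e) (θ^ a h))) (θ^-mono-≤ 1≤a {f} {e ℤ.+ h} f≤e+h)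
    where
    θ^ft≡θ^eΠ : θ^ a f * t ≡ θ^ a e * Π
    θ^ft≡θ^eΠ = ≈±-positive θ^ft≈±θ^eΠ (positive-* (positive-θ^ f) (positive-≤θ positive-θ⁻¹ (<θ⇒≤θ θ⁻¹<t)))
                                       (positive-* (positive-θ^ e) (positive-≤θ (positive-θ^ l) θ^l≤Π))
    e+l≤f = proj₁ (power-sandwich 1≤a e f l h θ⁻¹<t t<θ θ^l≤Π Π≤θ^h θ^ft≡θ^eΠ)
    f≤e+h = proj₂ (power-sandwich 1≤a e f l h θ⁻¹<t t<θ θ^l≤Π Π≤θ^h θ^ft≡θ^eΠ)

  infranorm-product-bounds : 1 ℕ.≤ a → ∀ k (x n : Fin k → Zθ) → (∀ i → IsInfranorm a (x i) (n i)) →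
                             ∀ N → IsInfranorm a (prodθ a k x) N →
                             θ^ a (ℤ.- + k) * prodθ a k n ≤θ N × N ≤θ θ^ a (+ k) * prodθ a k n
  infranorm-product-bounds 1≤a k x n x↦n N ∏x↦N =
    zeroOrPower-sandwich 1≤a {l = ℤ.- + k} {h = + k} zeroOrPower (prod-zeroOrPower k Factor.zeroOrPower)
      θ⁻¹<cofactor cofactor<θ (proj₁ Π-bounds) (proj₂ Π-bounds) (≈±-trans (≈±-sym σ≈±*cofactor) σ∏x≈±∏n*Π)
    where
    module Factor i = ConjugateFactorisation (infranorm-factorisation 1≤a (x↦n i))
    open ConjugateFactorisation (infranorm-factorisation 1≤a ∏x↦N)
    Π = prodθ a k Factor.cofactor
    Π-bounds = prod-bounds k Factor.cofactor
      (λ i → <θ⇒≤θ (Factor.θ⁻¹<cofactor i)) (λ i → <θ⇒≤θ (Factor.cofactor<θ i))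
    σ∏x≈±∏n*Π : σ (prodθ a k x) ≈± prodθ a k n * Π
    σ∏x≈±∏n*Π = subst₂ _≈±_ (sym (σ-prod k x)) (prod-* k n Factor.cofactor) (prod-≈± k Factor.σ≈±*cofactor)

open import Data.Nat using (_≤_)
open import Data.Integer using (-_)

-- The bounds hold for every k.
theorem5 : (a : ℕ) → 1 ≤ a → (k : ℕ) → 2 ≤ k
    → (x : Fin k → Zθ) → (n : Fin k → Zθ) → (∀ i → IsInfranorm a (x i) (n i))
    → (N : Zθ) → IsInfranorm a (prodθ a k x) N
    → Leθ a (mulθ a (θ^ a (- (+ k))) (prodθ a k n)) N
    × Leθ a N (mulθ a (θ^ a (+ k)) (prodθ a k n))
theorem5 a 1≤a k _ x n x↦n N ∏x↦N =
  Product.map (ℤ[θ].≤θ⇒Leθ a) (ℤ[θ].≤θ⇒Leθ a) (ℤ[θ].infranorm-product-bounds a 1≤a k x n x↦n N ∏x↦N)
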